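{- Let $(A,\mathrm{Con},\vdash,\Delta)$ be an information system with witnesses. Then the following two conditions are equivalent. (ALG) For all $(i,X)\in\mathrm{Con}$ and finite $F\subseteq A$, if $(i,X)\vdash F$, then there is $(j,V)\in\mathrm{Con}$ with $(j,V)\vdash(j,V)$, $(i,X)\vdash(j,V)$ and $(j,V)\vdash F$. (SALG) For all $(i,X)\in\mathrm{Con}$ and $a\in A$, if $(i,X)\vdash a$, then there is $Z\in\mathrm{Con}(i)$ with $(i,X)\vdash Z$, $(i,Z)\vdash Z$ and $(i,Z)\vdash a$.
   Context: An information system with witnesses is a tuple $(A,\mathrm{Con},\vdash,\Delta)$ with $A$ a set, $\Delta\in A$, $\mathrm{Con}\subseteq A\times\mathcal{P}_f(A)$ ($\mathcal{P}_f(A)$ being the finite subsets of $A$) and $\vdash\subseteq\mathrm{Con}\times A$. Write $\mathrm{Con}(i)=\{X:(i,X)\in\mathrm{Con}\}$, write $(i,X)\vdash Y$ if $(i,X)\vdash b$ for all $b\in Y$, and write $(i,X)\vdash(e,Z)$ if $(i,X)\vdash e$ and $(i,X)\vdash Z$. The following are required for all $i,j,a\in A$ and all finite $X,Y\subseteq A$: (1) $\{i\}\in\mathrm{Con}(i)$; (2) if $Y\subseteq X\in\mathrm{Con}(i)$, then $Y\in\mathrm{Con}(i)$; (3) $(i,\emptyset)\vdash\Delta$; (4) if $X\in\mathrm{Con}(i)$ and $(i,X)\vdash Y$, then $Y\in\mathrm{Con}(i)$; (5) if $X,Y\in\mathrm{Con}(i)$, $X\subseteq Y$ and $(i,X)\vdash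 a$, then $(i,Y)\vdash a$; (6) if $X\in\mathrm{Con}(i)$, $(i,X)\vdash Y$ and $(i,Y)\vdash a$, then $(i,X)\vdash a$; (7) if $\{i\}\in\mathrm{Con}(j)$, then $\mathrm{Con}(i)\subseteq\mathrm{Con}(j)$; (8) if $\{i\}\in\mathrm{Con}(j)$, $X\in\mathrm{Con}(i)$ and $(i,X)\vdash a$, then $(j,X)\vdash a$; (9) if $\{i\}\in\mathrm{Con}(j)$, $X\in\mathrm{Con}(i)$ and $(j,X)\vdash a$, then $(i,X)\vdash a$; (10) if $(i,X)\vdash Y$, then there is $(e,Z)\in\mathrm{Con}$ with $(i,X)\vdash(e,Z)$ and $(e,Z)\vdash Y$. -}

module Defs where

open import Level using (Level; suc; _⊔_)
open import Data.List using (List; []; _∷_)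
open import Data.List.Membership.Propositional using (_∈_)
open import Data.List.Relation.Unary.All using (All)
open import Data.List.Relation.Binary.Subset.Propositional using (_⊆_)
open import Data.Product using (Σ; ∃; _×_; _,_)

-- Finite subsets of A are represented by lists (membership = set membership).
-- All axioms only refer to membership/inclusion, so the representation is harmless
-- (axiom (2) and (5) make Con and ⊢ invariant under lists with equal element sets).

record InfoSysWitness (ℓ : Level) : Set (suc ℓ) where
  field
    A     : Set ℓ
    Δ     : A
    -- Con i X  means  (i , X) ∈ Con, i.e. X ∈ Con(i)
    Con   : A → List A → Set ℓ
    -- Ent i X a  means  (i , X) ⊢ a ; only meaningful for (i , X) ∈ Con
    Ent   : A → List A → A → Set ℓ

  Ents : A → List A → List A → Set ℓ
  Ents i X Y = All (Ent i X) Y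

  EntP : A → List A → A → List A → Set ℓ
  EntP i X e Z = Ent i X e × Ents i X Z

  field
    ent-con : ∀ {i X a} → Ent i X a → Con i X
    ax1  : ∀ i → Con i (i ∷ [])
    ax2  : ∀ {i X Y} → Y ⊆ X → Con i X → Con i Y
    ax3  : ∀ {i} → Ent i [] Δ
    ax4  : ∀ {i X Y} → Con i X → Ents i X Y → Con i Y
    ax5  : ∀ {i X Y a} → Con i X → Con i Y → X ⊆ Y → Ent i X a → Ent i Y a
    ax6  : ∀ {i X Y a} → Con i X → Ents i X Y → Ent i Y a → Ent i X a
    ax7  : ∀ {i j X} → Con j (i ∷ []) → Con i X → Con j X
    ax8  : ∀ {i j X a} → Con j (i ∷ []) → Con i X → Ent i X a → Ent j X a
    ax9  : ∀ {i j X a} → Con j (i ∷ []) → Con i X → Ent j X a → Ent i X a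
    -- (10): here ⊢ is a relation on Con × A, so (i , X) ⊢ Y presupposes (i , X) ∈ Con
    ax10 : ∀ {i X Y} → Con i X → Ents i X Y →
           Σ A λ e → Σ (List A) λ Z → Con e Z × EntP i X e Z × Ents e Z Y

  ALG : Set ℓ
  ALG = ∀ i X (F : List A) → Con i X → Ents i X F →
        Σ A λ j → Σ (List A) λ V →
          Con j V × EntP j V j V × EntP i X j V × Ents j V F

  SALG : Set ℓ
  SALG = ∀ i X a → Con i X → Ent i X a →
         Σ (List A) λ Z → Con i Z × Ents i X Z × Ents i Z Z × Ent i Z a

-- (SALG) ⇒ (ALG): the SALG-interpolants of the finitely many elements of F
-- are united into one self-entailing Z with (i , X) ⊢ Z ⊢ F.  Axiom (10)
-- applied to (i , Z) ⊢ Z yields a witness e with (i , Z) ⊢ e, and since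
-- {e} ∈ Con(i), axiom (9) moves every entailment from i to e; (j , V) is (e , Z).
-- (ALG) ⇒ (SALG): conversely (i , X) ⊢ j gives {j} ∈ Con(i), and axiom (8)
-- moves the entailments of (j , V) back to i.
module Submission where

open import Defs
open import Level using (Level)
open import Function.Bundles using (_⇔_; mk⇔)
open import Data.List using (List; []; _∷_; _++_)
open import Data.List.Relation.Unary.All as All using ([]; _∷_)
open import Data.List.Relation.Unary.All.Properties using (++⁺)
open import Data.List.Relation.Binary.Subset.Propositional using (_⊆_)
open import Data.List.Relation.Binary.Subset.Propositional.Properties
  using (xs⊆xs++ys; xs⊆ys++xs)
open import Data.Product using (Σ; _×_; _,_)

module _ {ℓ : Level} (S : InfoSysWitness ℓ) where
  open InfoSysWitness S

  con-singleton : ∀ {i X j} → Con i X → Ent i X j → Con i (j ∷ [])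
  con-singleton cX eXj = ax4 cX (eXj ∷ [])

  ents-mono : ∀ {i X Y F} → Con i X → Con i Y → X ⊆ Y → Ents i X F → Ents i Y F
  ents-mono cX cY X⊆Y = All.map (ax5 cX cY X⊆Y)

  ents-lift : ∀ {i j X F} → Con j (i ∷ []) → Con i X → Ents i X F → Ents j X F
  ents-lift cij cX = All.map (ax8 cij cX)

  ents-lower : ∀ {i j X F} → Con j (i ∷ []) → Con i X → Ents j X F → Ents i X F
  ents-lower cij cX = All.map (ax9 cij cX)

  Interpolant : A → List A → List A → Set ℓ
  Interpolant i X F =
    Σ (List A) λ Z → Con i Z × Ents i X Z × Ents i Z Z × Ents i Z F

  interpolant-[] : ∀ {i X} → Con i X → Interpolant i X []
  interpolant-[] cX = [] , ax2 (λ ()) cX , [] , [] , []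

  interpolant-++ : ∀ {i X F G} → Con i X →
    Interpolant i X F → Interpolant i X G → Interpolant i X (F ++ G)
  interpolant-++ {i} cX (Z , cZ , eXZ , eZZ , eZF) (W , cW , eXW , eWW , eWG) =
    Z ++ W , cZW , eXZW , ++⁺ (toZW eZZ) (fromW eWW) , ++⁺ (toZW eZF) (fromW eWG)
    where
    eXZW = ++⁺ eXZ eXW
    cZW = ax4 cX eXZW
    toZW : ∀ {F} → Ents i Z F → Ents i (Z ++ W) F
    toZW = ents-mono cZ cZW (xs⊆xs++ys Z W)
    fromW : ∀ {F} → Ents i W F → Ents i (Z ++ W) F
    fromW = ents-mono cW cZW (xs⊆ys++xs W Z)

  salg⇒interpolant : SALG → ∀ {i X} F → Con i X → Ents i X F → Interpolant i X F
  salg⇒interpolant salg []      cX []          = interpolant-[] cX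
  salg⇒interpolant salg {i} {X} (a ∷ F) cX (eXa ∷ eXF) with salg i X a cX eXa
  ... | Z , cZ , eXZ , eZZ , eZa =
    interpolant-++ cX (Z , cZ , eXZ , eZZ , eZa ∷ [])
                      (salg⇒interpolant salg F cX eXF)

  self-entailing⇒witness : ∀ {i Z} → Con i Z → Ents i Z Z →
    Σ A λ e → Con e Z × Con i (e ∷ []) × Ent i Z e
  self-entailing⇒witness cZ eZZ with ax10 cZ eZZ
  ... | e , Y , cY , (eZe , _) , eYZ = e , ax4 cY eYZ , con-singleton cZ eZe , eZe

  alg⇒salg : ALG → SALG
  alg⇒salg alg i X a cX eXa with alg i X (a ∷ []) cX (eXa ∷ [])
  ... | j , V , cV , (_ , eVV) , (eXj , eXV) , eVa =
    V , ax7 cij cV , eXV , ents-lift cij cV eVV , All.head (ents-lift cij cV eVa)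
    where cij = con-singleton cX eXj

  salg⇒alg : SALG → ALG
  salg⇒alg salg i X F cX eXF with salg⇒interpolant salg F cX eXF
  ... | Z , cZ , eXZ , eZZ , eZF with self-entailing⇒witness cZ eZZ
  ... | e , ceZ , cie , eZe =
    e , Z , ceZ , (ax9 cie ceZ eZe , lower eZZ) , (ax6 cX eXZ eZe , eXZ) , lower eZF
    where
    lower : ∀ {G} → Ents i Z G → Ents e Z G
    lower = ents-lower cie ceZ

lemma3p17 : ∀ {ℓ : Level} (S : InfoSysWitness ℓ) →
    InfoSysWitness.ALG S ⇔ InfoSysWitness.SALG S
lemma3p17 S = mk⇔ (alg⇒salg S) (salg⇒alg S)
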